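{- Let $C(q)=\sum_{j\ge 0}C_j q^j$ be a formal power series with $C(0)=1$, and let $(s_{n,k})_{n\ge 1,\,1\le k\le n}$ be complex numbers such that, for every sequence $\{a_n\}_{n\ge 1}$ of complex numbers, \[ \sum_{n\ge 1}\frac{a_n q^n}{1-q^n}=\frac{1}{C(q)}\sum_{n\ge 1}\Big(\sum_{k=1}^n s_{n,k}a_k\Big)q^n \] as formal power series in $q$. Set $s_{n,k}:=0$ for $k>n$. Then for all integers $n,k\ge 1$, \[ \text{(i)}\quad s_{n,k}=\sum_{i=1}^{\lfloor n/k\rfloor}[q^{n-ik}]\,C(q), \qquad\text{(ii)}\quad s_{n,k}=[q^n]\,\frac{q^k}{1-q^k}\,C(q). \]
   Context: $[q^m]F(q)$ denotes the coefficient of $q^m$ in the formal power series $F(q)$. -}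

module Defs where

open import Level using (Level)
open import Algebra.Bundles using (CommutativeRing)
open import Data.Nat using (ℕ; zero; suc; _∸_; NonZero; _/_)
import Data.Nat as ℕ
open import Data.Nat.Divisibility using (_∣?_)
open import Relation.Nullary.Decidable using (does)
open import Data.Bool using (if_then_else_)

module PowerSeries {c ℓ : Level} (R : CommutativeRing c ℓ) where
  open CommutativeRing R

  Series : Set c
  Series = ℕ → Carrier

  sumTo : (ℕ → Carrier) → ℕ → Carrier
  sumTo f zero    = 0#
  sumTo f (suc n) = sumTo f n + f n

  _≈ₛ_ : Series → Series → Set ℓ
  f ≈ₛ g = ∀ m → f m ≈ g m

  oneₛ : Series
  oneₛ zero    = 1#
  oneₛ (suc _) = 0#

  _*ₛ_ : Series → Series → Series
  (f *ₛ g) m = sumTo (λ i → f i * g (m ∸ i)) (suc m)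

  -- q^k / (1 - q^k) = Σ_{j ≥ 1} q^{jk}  (for k ≥ 1)
  geomₛ : ℕ → Series
  geomₛ k zero    = 0#
  geomₛ k (suc m) = if does (k ∣? suc m) then 1# else 0#

  -- Lambert series  Σ_{n ≥ 1} a_n q^n / (1 - q^n);
  -- its m-th coefficient is the finite sum Σ_{n=1}^{m} a_n [q^m] q^n/(1-q^n)
  lambertₛ : (ℕ → Carrier) → Series
  lambertₛ a m = sumTo (λ i → a (suc i) * geomₛ (suc i) m) m

  transformₛ : (ℕ → ℕ → Carrier) → (ℕ → Carrier) → Series
  transformₛ s a n = sumTo (λ i → s n (suc i) * a (suc i)) n

  divSum : Series → (n k : ℕ) → .{{NonZero k}} → Carrier
  divSum C n k = sumTo (λ i → C (n ∸ (suc i ℕ.* k))) (n / k)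

-- Feeding the indicator sequence a = δ_k into the hypothesis turns the
-- Lambert series into q^k/(1-q^k) and the right-hand side into D times the
-- k-th column Σ_n s_{n,k} q^n; multiplying by C = D⁻¹ gives (ii).  Expanding
-- the Cauchy product in (ii), only the multiples i k of k contribute, which is (i).
module Submission where

open import Defs
open import Level using (Level)
open import Algebra.Bundles using (CommutativeRing)
open import Data.Nat using (ℕ; _<_; _≤_; NonZero)
open import Data.Product using (_×_)

open import Data.Nat as ℕ using (zero; suc; _∸_; _/_; _%_; _≟_; s≤s)
open import Data.Nat.Properties
  using (m≤n⇒m<n∨m≡n; <-≤-connex; ≤-refl; m<n⇒m<1+n; ≤-pred; <⇒≢; <-≤-trans; <⇒≱;
         suc-injective; n∸n≡0; +-∸-assoc; ∸-+-assoc; m+[n∸m]≡n; m∸[m∸n]≡n)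
open import Data.Nat.DivMod
  using (m≡m%n+[m/n]*n; m%n<n; /-congˡ; m*n/n≡m; m/n*n≡m; +-distrib-/-∣ʳ;
         m<n⇒m/n≡0; %-congˡ; [m+kn]%n≡m%n; m<n⇒m%n≡m; 0/n≡0)
open import Data.Nat.Divisibility using (_∣_; _∤_; _∣?_; divides; n∣m*n; n∣m⇒m%n≡0; ∣⇒≤)
open import Data.Product using (_,_)
open import Data.Sum using (_⊎_; inj₁; inj₂)
open import Data.Empty using (⊥-elim-irr)
open import Relation.Nullary using (does)
open import Data.Bool using (if_then_else_)
open import Relation.Nullary.Decidable using (dec-true; dec-false)
open import Relation.Binary.PropositionalEquality as ≡ using (_≡_; _≢_)
import Relation.Binary.Reasoning.Setoid as SetoidReasoning

suc-/-step : ∀ m k .{{_ : NonZero k}} →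
  (k ∣ suc m × suc m / k ≡ suc (m / k)) ⊎ (k ∤ suc m × suc m / k ≡ m / k)
suc-/-step m k with m≤n⇒m<n∨m≡n (m%n<n m k)
... | inj₂ 1+r≡k = inj₁ (divides (suc q) (≡.sym [1+q]*k≡1+m) , quotient)
  where
  q = m / k
  [1+q]*k≡1+m : suc q ℕ.* k ≡ suc m
  [1+q]*k≡1+m = ≡.trans (≡.cong (ℕ._+ q ℕ.* k) (≡.sym 1+r≡k)) (≡.cong suc (≡.sym (m≡m%n+[m/n]*n m k)))
  quotient : suc m / k ≡ suc q
  quotient = ≡.trans (/-congˡ (≡.sym [1+q]*k≡1+m)) (m*n/n≡m (suc q) k)
... | inj₁ 1+r<k = inj₂ (k∤1+m , quotient)
  where
  r = m % k
  q = m / k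
  split : suc m ≡ suc r ℕ.+ q ℕ.* k
  split = ≡.cong suc (m≡m%n+[m/n]*n m k)
  quotient : suc m / k ≡ q
  quotient = begin
    suc m / k                  ≡⟨ /-congˡ split ⟩
    (suc r ℕ.+ q ℕ.* k) / k    ≡⟨ +-distrib-/-∣ʳ (suc r) (n∣m*n q) ⟩
    suc r / k ℕ.+ q ℕ.* k / k  ≡⟨ ≡.cong₂ ℕ._+_ (m<n⇒m/n≡0 1+r<k) (m*n/n≡m q k) ⟩
    q                          ∎
    where open ≡.≡-Reasoning
  k∤1+m : k ∤ suc m
  k∤1+m k∣1+m with ≡.trans (≡.sym (n∣m⇒m%n≡0 (suc m) k k∣1+m))
                    (≡.trans (%-congˡ split) (≡.trans ([m+kn]%n≡m%n (suc r) q k) (m<n⇒m%n≡m 1+r<k)))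
  ... | ()

module _ {c ℓ : Level} (R : CommutativeRing c ℓ) where
  open CommutativeRing R
  open PowerSeries R
  open SetoidReasoning setoid

  sumTo-cong : ∀ {f g} n → (∀ i → i < n → f i ≈ g i) → sumTo f n ≈ sumTo g n
  sumTo-cong zero    f≈g = refl
  sumTo-cong (suc n) f≈g = +-cong (sumTo-cong n (λ i i<n → f≈g i (m<n⇒m<1+n i<n))) (f≈g n ≤-refl)

  sumTo-zero : ∀ {f} n → (∀ i → i < n → f i ≈ 0#) → sumTo f n ≈ 0#
  sumTo-zero zero    f≈0 = refl
  sumTo-zero (suc n) f≈0 =
    trans (+-cong (sumTo-zero n (λ i i<n → f≈0 i (m<n⇒m<1+n i<n))) (f≈0 n ≤-refl)) (+-identityˡ 0#)

  sumTo-single : ∀ {f} j n → (∀ i → i ≢ j → f i ≈ 0#) → j < n → sumTo f n ≈ f j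
  sumTo-single j (suc n) f≈0 j<1+n with m≤n⇒m<n∨m≡n (≤-pred j<1+n)
  ... | inj₁ j<n    = trans (+-cong (sumTo-single j n f≈0 j<n) (f≈0 n (λ n≡j → <⇒≢ j<n (≡.sym n≡j))))
                            (+-identityʳ _)
  ... | inj₂ ≡.refl = trans (+-congʳ (sumTo-zero n (λ i i<n → f≈0 i (<⇒≢ i<n)))) (+-identityˡ _)

  sumTo-+ : ∀ f g n → sumTo (λ i → f i + g i) n ≈ sumTo f n + sumTo g n
  sumTo-+ f g zero    = sym (+-identityˡ 0#)
  sumTo-+ f g (suc n) = begin
    sumTo (λ i → f i + g i) n + (f n + g n)  ≈⟨ +-congʳ (sumTo-+ f g n) ⟩
    (sumTo f n + sumTo g n) + (f n + g n)    ≈⟨ +-assoc _ _ _ ⟩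
    sumTo f n + (sumTo g n + (f n + g n))    ≈⟨ +-congˡ (trans (sym (+-assoc _ _ _)) (+-congʳ (+-comm _ _))) ⟩
    sumTo f n + ((f n + sumTo g n) + g n)    ≈⟨ +-congˡ (+-assoc _ _ _) ⟩
    sumTo f n + (f n + (sumTo g n + g n))    ≈⟨ sym (+-assoc _ _ _) ⟩
    (sumTo f n + f n) + (sumTo g n + g n)    ∎

  *-distribˡ-sumTo : ∀ x f n → x * sumTo f n ≈ sumTo (λ i → x * f i) n
  *-distribˡ-sumTo x f zero    = zeroʳ x
  *-distribˡ-sumTo x f (suc n) = trans (distribˡ x _ _) (+-congʳ (*-distribˡ-sumTo x f n))

  *-distribʳ-sumTo : ∀ x f n → sumTo f n * x ≈ sumTo (λ i → f i * x) n
  *-distribʳ-sumTo x f zero    = zeroˡ x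
  *-distribʳ-sumTo x f (suc n) = trans (distribʳ x _ _) (+-congʳ (*-distribʳ-sumTo x f n))

  sumTo-suc : ∀ f n → sumTo f (suc n) ≈ f 0 + sumTo (λ i → f (suc i)) n
  sumTo-suc f zero    = trans (+-identityˡ _) (sym (+-identityʳ _))
  sumTo-suc f (suc n) = trans (+-congʳ (sumTo-suc f n)) (+-assoc _ _ _)

  sumTo-reverse : ∀ f n → sumTo f (suc n) ≈ sumTo (λ i → f (n ∸ i)) (suc n)
  sumTo-reverse f zero    = refl
  sumTo-reverse f (suc n) = begin
    sumTo f (suc n) + f (suc n)                  ≈⟨ +-congʳ (sumTo-reverse f n) ⟩
    sumTo (λ i → f (n ∸ i)) (suc n) + f (suc n)  ≈⟨ +-comm _ _ ⟩
    f (suc n) + sumTo (λ i → f (n ∸ i)) (suc n)  ≈⟨ sym (sumTo-suc (λ i → f (suc n ∸ i)) (suc n)) ⟩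
    sumTo (λ i → f (suc n ∸ i)) (suc (suc n))    ∎

  sumTo-extend-∸ : ∀ g {i} n → i ≤ n → sumTo g (suc (n ∸ i)) + g (suc n ∸ i) ≈ sumTo g (suc (suc n ∸ i))
  sumTo-extend-∸ g n i≤n rewrite +-∸-assoc 1 i≤n = refl

  sumTo-triangle : ∀ (G : ℕ → ℕ → Carrier) n →
    sumTo (λ m → sumTo (λ i → G i (m ∸ i)) (suc m)) (suc n)
      ≈ sumTo (λ i → sumTo (G i) (suc (n ∸ i))) (suc n)
  sumTo-triangle G zero    = refl
  sumTo-triangle G (suc n) = begin
    sumTo antidiagonal (suc n) + antidiagonal (suc n)
      ≈⟨ +-congʳ (sumTo-triangle G n) ⟩
    sumTo (rows n) (suc n) + (sumTo (λ i → G i (suc n ∸ i)) (suc n) + G (suc n) (n ∸ n))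
      ≈⟨ sym (+-assoc _ _ _) ⟩
    (sumTo (rows n) (suc n) + sumTo (λ i → G i (suc n ∸ i)) (suc n)) + G (suc n) (n ∸ n)
      ≈⟨ +-cong (sym (sumTo-+ _ _ (suc n))) lastRow ⟩
    sumTo (λ i → rows n i + G i (suc n ∸ i)) (suc n) + rows (suc n) (suc n)
      ≈⟨ +-congʳ (sumTo-cong (suc n) (λ i i<1+n → sumTo-extend-∸ (G i) n (≤-pred i<1+n))) ⟩
    sumTo (rows (suc n)) (suc (suc n)) ∎
    where
    antidiagonal : ℕ → Carrier
    antidiagonal m = sumTo (λ i → G i (m ∸ i)) (suc m)
    rows : ℕ → ℕ → Carrier
    rows n i = sumTo (G i) (suc (n ∸ i))
    lastRow : G (suc n) (n ∸ n) ≈ rows (suc n) (suc n)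
    lastRow rewrite n∸n≡0 n = sym (+-identityˡ _)

  *ₛ-congˡ : ∀ {f f′} g → f ≈ₛ f′ → (f *ₛ g) ≈ₛ (f′ *ₛ g)
  *ₛ-congˡ g f≈f′ m = sumTo-cong (suc m) (λ i _ → *-congʳ (f≈f′ i))

  *ₛ-congʳ : ∀ f {g g′} → g ≈ₛ g′ → (f *ₛ g) ≈ₛ (f *ₛ g′)
  *ₛ-congʳ f g≈g′ m = sumTo-cong (suc m) (λ i _ → *-congˡ (g≈g′ (m ∸ i)))

  *ₛ-comm : ∀ f g → (f *ₛ g) ≈ₛ (g *ₛ f)
  *ₛ-comm f g m = trans (sumTo-reverse _ m) (sumTo-cong (suc m) λ i i<1+m →
    trans (*-comm _ _) (*-congʳ (reflexive (≡.cong g (m∸[m∸n]≡n (≤-pred i<1+m))))))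

  *ₛ-identityˡ : ∀ f → (oneₛ *ₛ f) ≈ₛ f
  *ₛ-identityˡ f m = begin
    sumTo (λ i → oneₛ i * f (m ∸ i)) (suc m)       ≈⟨ sumTo-suc _ m ⟩
    1# * f m + sumTo (λ i → 0# * f (m ∸ suc i)) m  ≈⟨ +-cong (*-identityˡ _) (sumTo-zero m (λ i _ → zeroˡ _)) ⟩
    f m + 0#                                       ≈⟨ +-identityʳ _ ⟩
    f m                                            ∎

  *ₛ-assoc : ∀ f g h → (f *ₛ (g *ₛ h)) ≈ₛ ((f *ₛ g) *ₛ h)
  *ₛ-assoc f g h n = begin
    sumTo (λ i → f i * sumTo (λ j → g j * h ((n ∸ i) ∸ j)) (suc (n ∸ i))) (suc n)
      ≈⟨ sumTo-cong (suc n) (λ i _ → trans (*-distribˡ-sumTo (f i) _ (suc (n ∸ i)))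
           (sumTo-cong (suc (n ∸ i)) λ j _ → trans (sym (*-assoc _ _ _)) (*-congˡ (reflexive (≡.cong h (∸-+-assoc n i j)))))) ⟩
    sumTo (λ i → sumTo (G i) (suc (n ∸ i))) (suc n)
      ≈⟨ sym (sumTo-triangle G n) ⟩
    sumTo (λ m → sumTo (λ i → G i (m ∸ i)) (suc m)) (suc n)
      ≈⟨ sumTo-cong (suc n) (λ m _ → trans
           (sumTo-cong (suc m) (λ i i<1+m → *-congˡ (reflexive (≡.cong (λ t → h (n ∸ t)) (m+[n∸m]≡n (≤-pred i<1+m))))))
           (sym (*-distribʳ-sumTo _ _ (suc m)))) ⟩
    ((f *ₛ g) *ₛ h) n ∎
    where
    G : ℕ → ℕ → Carrier
    G i j = (f i * g j) * h (n ∸ (i ℕ.+ j))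

  *ₛ-solveˡ : ∀ {C D G T} → (C *ₛ D) ≈ₛ oneₛ → G ≈ₛ (D *ₛ T) → T ≈ₛ (C *ₛ G)
  *ₛ-solveˡ {C} {D} {G} {T} CD≈1 G≈DT n = begin
    T n                ≈⟨ sym (*ₛ-identityˡ T n) ⟩
    (oneₛ *ₛ T) n      ≈⟨ sym (*ₛ-congˡ T CD≈1 n) ⟩
    ((C *ₛ D) *ₛ T) n  ≈⟨ sym (*ₛ-assoc C D T n) ⟩
    (C *ₛ (D *ₛ T)) n  ≈⟨ sym (*ₛ-congʳ C G≈DT n) ⟩
    (C *ₛ G) n         ∎

  geomₛ-∣ : ∀ k m → k ∣ suc m → geomₛ k (suc m) ≈ 1#
  geomₛ-∣ k m k∣1+m rewrite dec-true (k ∣? suc m) k∣1+m = refl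

  geomₛ-∤ : ∀ k m → k ∤ suc m → geomₛ k (suc m) ≈ 0#
  geomₛ-∤ k m k∤1+m rewrite dec-false (k ∣? suc m) k∤1+m = refl

  geomₛ-< : ∀ k m → m < suc k → geomₛ (suc k) m ≈ 0#
  geomₛ-< k zero    _       = refl
  geomₛ-< k (suc m) 1+m<1+k = geomₛ-∤ (suc k) m (λ 1+k∣1+m → <⇒≱ 1+m<1+k (∣⇒≤ 1+k∣1+m))

  sumTo-geomₛ : ∀ k .{{_ : NonZero k}} (f : ℕ → Carrier) m →
    sumTo (λ i → geomₛ k i * f i) (suc m) ≈ sumTo (λ j → f (suc j ℕ.* k)) (m / k)
  sumTo-geomₛ k f zero = begin
    0# + 0# * f 0                        ≈⟨ trans (+-identityˡ _) (zeroˡ _) ⟩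
    0#                                   ≡⟨ ≡.cong (sumTo _) (≡.sym (0/n≡0 k)) ⟩
    sumTo (λ j → f (suc j ℕ.* k)) (0 / k) ∎
  sumTo-geomₛ k f (suc m) with suc-/-step m k
  ... | inj₁ (k∣1+m , quotient) = begin
    sumTo (λ i → geomₛ k i * f i) (suc m) + geomₛ k (suc m) * f (suc m)
      ≈⟨ +-cong (sumTo-geomₛ k f m) (trans (*-congʳ (geomₛ-∣ k m k∣1+m)) (*-identityˡ _)) ⟩
    sumTo multiples (m / k) + f (suc m)
      ≡⟨ ≡.cong (λ t → sumTo multiples (m / k) + f t) (≡.sym (≡.trans (≡.cong (ℕ._* k) (≡.sym quotient)) (m/n*n≡m k∣1+m))) ⟩
    sumTo multiples (suc (m / k))
      ≡⟨ ≡.cong (sumTo multiples) (≡.sym quotient) ⟩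
    sumTo multiples (suc m / k) ∎
    where multiples = λ j → f (suc j ℕ.* k)
  ... | inj₂ (k∤1+m , quotient) = begin
    sumTo (λ i → geomₛ k i * f i) (suc m) + geomₛ k (suc m) * f (suc m)
      ≈⟨ +-cong (sumTo-geomₛ k f m) (trans (*-congʳ (geomₛ-∤ k m k∤1+m)) (zeroˡ _)) ⟩
    sumTo multiples (m / k) + 0#
      ≈⟨ +-identityʳ _ ⟩
    sumTo multiples (m / k)
      ≡⟨ ≡.cong (sumTo multiples) (≡.sym quotient) ⟩
    sumTo multiples (suc m / k) ∎
    where multiples = λ j → f (suc j ℕ.* k)

  geomₛ-*ₛ≈divSum : ∀ (C : Series) n k .{{_ : NonZero k}} → (geomₛ k *ₛ C) n ≈ divSum C n k
  geomₛ-*ₛ≈divSum C n k = sumTo-geomₛ k (λ i → C (n ∸ i)) n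

  δ : ℕ → ℕ → Carrier
  δ k j = if does (j ≟ k) then 1# else 0#

  δ-self : ∀ k → δ k k ≈ 1#
  δ-self k rewrite dec-true (k ≟ k) ≡.refl = refl

  δ-other : ∀ k j → j ≢ k → δ k j ≈ 0#
  δ-other k j j≢k rewrite dec-false (j ≟ k) j≢k = refl

  lambertₛ-δ : ∀ k → lambertₛ (δ (suc k)) ≈ₛ geomₛ (suc k)
  lambertₛ-δ k m with <-≤-connex k m
  ... | inj₁ k<m = trans (sumTo-single k m off-k k<m) (trans (*-congʳ (δ-self (suc k))) (*-identityˡ _))
    where
    off-k : ∀ i → i ≢ k → δ (suc k) (suc i) * geomₛ (suc i) m ≈ 0#
    off-k i i≢k = trans (*-congʳ (δ-other (suc k) (suc i) (λ e → i≢k (suc-injective e)))) (zeroˡ _)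
  ... | inj₂ m≤k = trans (sumTo-zero m below-m) (sym (geomₛ-< k m (s≤s m≤k)))
    where
    below-m : ∀ i → i < m → δ (suc k) (suc i) * geomₛ (suc i) m ≈ 0#
    below-m i i<m = trans (*-congʳ (δ-other (suc k) (suc i) (λ e → <⇒≢ (<-≤-trans i<m m≤k) (suc-injective e))))
                          (zeroˡ _)

  transformₛ-δ : ∀ s → (∀ n k → n < k → s n k ≈ 0#) → ∀ k n → transformₛ s (δ (suc k)) n ≈ s n (suc k)
  transformₛ-δ s s-upper k n with <-≤-connex k n
  ... | inj₁ k<n = trans (sumTo-single k n off-k k<n) (trans (*-congˡ (δ-self (suc k))) (*-identityʳ _))
    where
    off-k : ∀ i → i ≢ k → s n (suc i) * δ (suc k) (suc i) ≈ 0#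
    off-k i i≢k = trans (*-congˡ (δ-other (suc k) (suc i) (λ e → i≢k (suc-injective e)))) (zeroʳ _)
  ... | inj₂ n≤k = trans (sumTo-zero n below-n) (sym (s-upper n (suc k) (s≤s n≤k)))
    where
    below-n : ∀ i → i < n → s n (suc i) * δ (suc k) (suc i) ≈ 0#
    below-n i i<n = trans (*-congˡ (δ-other (suc k) (suc i) (λ e → <⇒≢ (<-≤-trans i<n n≤k) (suc-injective e))))
                          (zeroʳ _)

theorem1 : {c ℓ : Level} (R : CommutativeRing c ℓ) →
    let open CommutativeRing R
        open PowerSeries R
    in (C D : Series) → C 0 ≈ 1# → (C *ₛ D) ≈ₛ oneₛ →
       (s : ℕ → ℕ → Carrier) →
       (∀ n k → n < k → s n k ≈ 0#) →
       (∀ (a : ℕ → Carrier) → lambertₛ a ≈ₛ (D *ₛ transformₛ s a)) →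
       ∀ (n k : ℕ) → 1 ≤ n → .{{_ : NonZero k}} →
         (s n k ≈ divSum C n k) × (s n k ≈ (geomₛ k *ₛ C) n)
theorem1 R C D _ CD≈1 s s-upper lambert n zero _ {{k≢0}} = ⊥-elim-irr (ℕ.≢-nonZero⁻¹ 0 {{k≢0}} ≡.refl)
theorem1 R C D _ CD≈1 s s-upper lambert n (suc k) _ =
  trans column≈geomC (geomₛ-*ₛ≈divSum R C n (suc k)) , column≈geomC
  where
  open CommutativeRing R
  open PowerSeries R
  a = δ R (suc k)
  column≈geomC : s n (suc k) ≈ (geomₛ (suc k) *ₛ C) n
  column≈geomC = begin
    s n (suc k)                ≈⟨ sym (transformₛ-δ R s s-upper k n) ⟩
    transformₛ s a n           ≈⟨ *ₛ-solveˡ R {T = transformₛ s a} CD≈1 (lambert a) n ⟩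
    (C *ₛ lambertₛ a) n        ≈⟨ *ₛ-congʳ R C (lambertₛ-δ R k) n ⟩
    (C *ₛ geomₛ (suc k)) n     ≈⟨ *ₛ-comm R C (geomₛ (suc k)) n ⟩
    (geomₛ (suc k) *ₛ C) n     ∎
    where open SetoidReasoning setoid
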